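{- Let $n\ge 3$ and let $P(G(n))$ be the power graph of the gyrogroup $(G(n),\oplus)$ described in the context. Then (1) $dds(P(G(n)))=\big((1,2^n-1),\ (1,2^{n-1}-1,2^{n-1})^{2^{n-1}-1},\ (1,1,2^n-2)^{2^{n-1}}\big)$; (2) $dds_D(P(G(n)))=\big((1,2^{n-1},\underbrace{0,\ldots,0}_{2^{n-1}-3},2^{n-1}-1),\ (1,\underbrace{0,\ldots,0}_{2^{n-1}-2},2^{n-1}-1,2^{n-1})^{2^{n-1}-1},\ (1,1,2^{n-1}-1,\underbrace{0,\ldots,0}_{2^{n-1}-3},2^{n-1}-1)^{2^{n-1}}\big)$.
   Context: Let $n\ge 3$ and $m=2^{n-1}$. Put $P(n)=\{0,1,\dots,m-1\}$, $H(n)=\{m,m+1,\dots,2^n-1\}$ and $G(n)=P(n)\cup H(n)$. Define a binary operation $\oplus$ on $G(n)$ by: $i\oplus j=t$ if $(i,j)\in P(n)\times P(n)$; $i\oplus j=t+m$ if $(i,j)\in P(n)\times H(n)$; $i\oplus j=s+m$ if $(i,j)\in H(n)\times P(n)$; $i\oplus j=k$ if $(i,j)\in H(n)\times H(n)$, where $t,s,k\in P(n)$ are determined by $t\equiv i+j$, $s\equiv i+(\tfrac m2-1)j$, $k\equiv(\tfrac m2+1)i+(\tfrac m2-1)j \pmod m$. Then $(G(n),\oplus)$ is a gyrogroup with identity $e=0$. Powers are defined by $a^1=a$, $a^{k+1}=a\oplus a^k$. The power graph $P(G(n))$ is the simple undirected graph with vertex set $G(n)$ in which two distinct vertices $u,v$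 are adjacent if and only if $u^k=v$ or $v^k=u$ for some positive integer $k$. For a vertex $u$ of a connected graph, let $deg_k(u)$ (resp. $Deg_k(u)$) be the number of vertices at shortest-path distance (resp. detour distance, i.e. length of a longest path) exactly $k$ from $u$. The distance degree sequence of $u$ is $dds(u)=(deg_0(u),deg_1(u),\dots,deg_{e(u)}(u))$, where $e(u)$ is the eccentricity, and the detour distance degree sequence is $dds_D(u)=(Deg_0(u),\dots,Deg_{e_D(u)}(u))$, where $e_D(u)$ is the detour eccentricity. $dds(G)$ (resp. $dds_D(G)$) is the multiset of these sequences over all vertices, where $(\dots)^r$ indicates a sequence occurring for $r$ vertices. -}

module Defs where

open import Data.Nat using (ℕ; zero; suc; _+_; _*_; _∸_; _^_; _≤_; _<_; _<?_)
open import Data.Nat.DivMod using (_%_; _/_)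
open import Data.Nat.Properties using (m^n≢0)
open import Data.Fin using (Fin; toℕ)
open import Data.List using (List; []; _∷_; length; lookup; map; upTo; replicate; _++_)
open import Data.List.Relation.Unary.Linked using (Linked)
open import Data.List.Relation.Unary.Unique.Propositional using (Unique)
open import Data.List.Membership.Propositional using (_∈_)
open import Data.List.Relation.Binary.Permutation.Propositional using (_↭_)
open import Data.Product using (Σ; ∃; _×_)
open import Data.Sum using (_⊎_)
open import Relation.Nullary using (¬_; yes; no)
open import Relation.Binary.PropositionalEquality using (_≡_)

-- The gyrogroup G(n) = {0, …, 2^n - 1}, with m = 2^(n-1).
-- P(n) = {0,…,m-1}, H(n) = {m,…,2^n-1}.

m : ℕ → ℕ
m n = 2 ^ (n ∸ 1)

_mod[_] : ℕ → ℕ → ℕ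
x mod[ n ] = _%_ x (m n) {{m^n≢0 2 (n ∸ 1)}}

half : ℕ → ℕ
half n = m n / 2

-- The operation ⊕ on G(n) (elements i are naturals; i ∈ P(n) iff i < m).
-- The congruences are taken mod m on the integer representatives i, j.
op : ℕ → ℕ → ℕ → ℕ
op n i j with i <? m n | j <? m n
... | yes _ | yes _ = (i + j) mod[ n ]
... | yes _ | no  _ = (i + j) mod[ n ] + m n
... | no  _ | yes _ = (i + (half n ∸ 1) * j) mod[ n ] + m n
... | no  _ | no  _ = ((half n + 1) * i + (half n ∸ 1) * j) mod[ n ]

-- Powers a^k for k ≥ 1: a^1 = a, a^(k+1) = a ⊕ a^k.
-- (The value at k = 0 is the identity e = 0 and is never used.)
power : ℕ → ℕ → ℕ → ℕ
power n a zero = 0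
power n a (suc zero) = a
power n a (suc (suc k)) = op n a (power n a (suc k))

Vertex : ℕ → ℕ → Set
Vertex n v = v < 2 ^ n

Adj : ℕ → ℕ → ℕ → Set
Adj n u v = Vertex n u × Vertex n v × ¬ (u ≡ v) ×
  ((∃ λ k → power n u (suc k) ≡ v) ⊎ (∃ λ k → power n v (suc k) ≡ u))

lastOf : ℕ → List ℕ → ℕ
lastOf x [] = x
lastOf _ (y ∷ ys) = lastOf y ys

PathLen : ℕ → ℕ → ℕ → ℕ → Set
PathLen n u v k = Σ (List ℕ) λ ys →
  Vertex n u × Linked (Adj n) (u ∷ ys) × Unique (u ∷ ys) ×
  lastOf u ys ≡ v × length ys ≡ k

Dist : ℕ → ℕ → ℕ → ℕ → Set
Dist n u v k = PathLen n u v k × (∀ j → PathLen n u v j → k ≤ j)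

Detour : ℕ → ℕ → ℕ → ℕ → Set
Detour n u v k = PathLen n u v k × (∀ j → PathLen n u v j → j ≤ k)

HasCount : ℕ → (ℕ → Set) → ℕ → Set
HasCount n P c = Σ (List ℕ) λ vs → Unique vs × length vs ≡ c ×
  (∀ v → (v ∈ vs → Vertex n v × P v) × (Vertex n v × P v → v ∈ vs))

DDSwrt : (ℕ → ℕ → ℕ → ℕ → Set) → ℕ → ℕ → List ℕ → Set
DDSwrt D n u s = Σ ℕ λ e →
  (∀ v → Vertex n v → ∃ λ k → k ≤ e × D n u v k) ×
  (∃ λ v → Vertex n v × D n u v e) ×
  length s ≡ suc e ×
  (∀ (i : Fin (length s)) → HasCount n (λ v → D n u v (toℕ i)) (lookup s i))

DDS : ℕ → ℕ → List ℕ → Set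
DDS = DDSwrt Dist

DDSD : ℕ → ℕ → List ℕ → Set
DDSD = DDSwrt Detour

SeqMultiset : (ℕ → ℕ → List ℕ → Set) → ℕ → List (List ℕ) → Set
SeqMultiset S n M = Σ (ℕ → List ℕ) λ f →
  (∀ u → Vertex n u → S n u (f u)) × (map f (upTo (2 ^ n)) ↭ M)

-- The claimed multisets.  (x)^r is rendered as replicate r x.

ddsTarget : ℕ → List (List ℕ)
ddsTarget n =
  ((1 ∷ 2 ^ n ∸ 1 ∷ []) ∷ []) ++
  replicate (2 ^ (n ∸ 1) ∸ 1) (1 ∷ 2 ^ (n ∸ 1) ∸ 1 ∷ 2 ^ (n ∸ 1) ∷ []) ++
  replicate (2 ^ (n ∸ 1)) (1 ∷ 1 ∷ 2 ^ n ∸ 2 ∷ [])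

ddsDTarget : ℕ → List (List ℕ)
ddsDTarget n =
  ((1 ∷ 2 ^ (n ∸ 1) ∷ []) ++ replicate (2 ^ (n ∸ 1) ∸ 3) 0 ++ (2 ^ (n ∸ 1) ∸ 1 ∷ [])) ∷ [] ++
  replicate (2 ^ (n ∸ 1) ∸ 1)
    ((1 ∷ []) ++ replicate (2 ^ (n ∸ 1) ∸ 2) 0 ++ (2 ^ (n ∸ 1) ∸ 1 ∷ 2 ^ (n ∸ 1) ∷ [])) ++
  replicate (2 ^ (n ∸ 1))
    ((1 ∷ 1 ∷ 2 ^ (n ∸ 1) ∸ 1 ∷ []) ++ replicate (2 ^ (n ∸ 1) ∸ 3) 0 ++ (2 ^ (n ∸ 1) ∸ 1 ∷ []))

-- The powers of an element u of P(n) = [0, m) are its multiples modulo m = 2^(n-1), while an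
-- element h of H(n) = [m, 2m) has powers h, 0, h, 0, ….  Of two residues modulo a power of 2 one
-- is always a multiple of the other (an odd residue generates everything, two even ones can be
-- halved), so P(n) is a clique of the power graph and the only further edges join 0 to H(n).
-- In this graph the distance and the detour distance from u to v depend only on which of {0},
-- P(n) ∖ {0}, H(n) contain u and v: a vertex of H(n) reaches everything through 0, and a longest
-- path between two vertices of P(n) passes through all of P(n).  Each degree sequence is then a
-- tally over these classes, of sizes 1, m - 1 and m.

module Submission where

open import Defs
open import Data.Bool using (if_then_else_; true; false)
open import Data.Empty using (⊥-elim)
open import Data.Fin using (toℕ)
open import Data.List using (List; []; _∷_; _++_; length; filter; applyUpTo; upTo; replicate)
open import Data.List.Properties
  using (length-++; length-++-sucʳ; ++-assoc; filter-++; length-applyUpTo; lookup-applyUpTo; length-upTo; upTo-∷ʳ; map-upTo)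
open import Data.List.Membership.Propositional using (_∈_)
open import Data.List.Membership.Propositional.Properties
  using (∈-∃++; ∈-++⁻; ∈-++⁺ˡ; ∈-++⁺ʳ; ∈-filter⁺; ∈-filter⁻; ∈-upTo⁺; ∈-upTo⁻)
open import Data.List.Relation.Binary.Disjoint.Propositional using (Disjoint)
open import Data.List.Relation.Binary.Permutation.Propositional using (↭-reflexive)
open import Data.List.Relation.Binary.Subset.Propositional using (_⊆_)
open import Data.List.Relation.Unary.All as All using (All; []; _∷_)
open import Data.List.Relation.Unary.AllPairs using ([]; _∷_)
open import Data.List.Relation.Unary.Any using (here; there)
open import Data.List.Relation.Unary.Linked using (Linked; []; [-]; _∷_)
open import Data.List.Relation.Unary.Unique.Propositional using (Unique)
open import Data.List.Relation.Unary.Unique.Propositional.Properties using (Unique[x∷xs]⇒x∉xs; ++⁺; filter⁺; upTo⁺)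
open import Data.Nat
open import Data.Nat.Coprimality using (Coprime; 1-coprimeTo; coprime-+; coprime-divisor; coprime-Bézout)
open import Data.Nat.Divisibility using (∣-trans; ∣1⇒≡1)
open import Data.Nat.DivMod
open import Data.Nat.GCD using (module Bézout)
open import Data.Nat.Properties
open import Data.Nat.Tactic.RingSolver using (solve-∀)
open import Data.Product using (∃; _×_; _,_; proj₁; proj₂)
open import Data.Sum using (_⊎_; inj₁; inj₂) renaming (map to ⊎-map)
open import Function using (_∘_)
open import Relation.Nullary using (¬_; Dec; does; yes; no)
open import Relation.Nullary.Decidable using (¬?; _×-dec_; dec-true; dec-false)
open import Relation.Binary.PropositionalEquality
  using (_≡_; _≢_; refl; sym; trans; cong; cong₂; subst; module ≡-Reasoning)
open ≡-Reasoning

even-or-odd : ∀ i → (∃ λ q → i ≡ 2 * q) ⊎ (∃ λ q → i ≡ suc (2 * q))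
even-or-odd zero = inj₁ (0 , refl)
even-or-odd (suc i) with even-or-odd i
... | inj₁ (q , refl) = inj₂ (q , refl)
... | inj₂ (q , refl) = inj₁ (suc q , cong suc (sym (+-suc q (q + 0))))

odd-coprime-2 : ∀ q → Coprime (suc (2 * q)) 2
odd-coprime-2 zero = 1-coprimeTo 2
odd-coprime-2 (suc q) rewrite +-suc q (q + 0) = coprime-+ (odd-coprime-2 q)

odd-coprime-2^ : ∀ q t → Coprime (suc (2 * q)) (2 ^ t)
odd-coprime-2^ q zero (_ , d∣1) = ∣1⇒≡1 d∣1
odd-coprime-2^ q (suc t) {d} (d∣o , d∣2^1+t) =
  odd-coprime-2^ q t (d∣o , coprime-divisor d⊥2 d∣2^1+t)
  where
  d⊥2 : Coprime d 2
  d⊥2 (e∣d , e∣2) = odd-coprime-2 q (∣-trans e∣d d∣o , e∣2)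

mod-cong : ∀ {a b} k l d .{{_ : NonZero d}} → a + k * d ≡ b + l * d → a % d ≡ b % d
mod-cong {a} {b} k l d eq = begin
  a % d            ≡⟨ [m+kn]%n≡m%n a k d ⟨
  (a + k * d) % d  ≡⟨ cong (_% d) eq ⟩
  (b + l * d) % d  ≡⟨ [m+kn]%n≡m%n b l d ⟩
  b % d            ∎

coprime⇒invertible : ∀ {i} d .{{_ : NonZero d}} → Coprime i d → ∃ λ a → (a * i) % d ≡ 1 % d
coprime⇒invertible {i} d@(suc d-1) i⊥d with coprime-Bézout i⊥d
... | Bézout.+- x y eq = x , mod-cong 0 y d (trans (+-identityʳ (x * i)) (sym eq))
-- Here x * i ≡ -1, so x * (d - 1) inverts i.
... | Bézout.-+ x y eq = x * d-1 , mod-cong y (x * i) d (begin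
  x * d-1 * i + y * d        ≡⟨ cong (x * d-1 * i +_) eq ⟨
  x * d-1 * i + (1 + x * i)  ≡⟨ regroup x d-1 i ⟩
  1 + x * i * d              ∎)
  where
  regroup : ∀ x d-1 i → x * d-1 * i + (1 + x * i) ≡ 1 + x * i * suc d-1
  regroup = solve-∀

invertible⇒generates : ∀ {a i} d .{{_ : NonZero d}} → (a * i) % d ≡ 1 % d →
  ∀ {j} → j < d → ((a * j) * i) % d ≡ j
invertible⇒generates {a} {i} d inv {j} j<d = begin
  ((a * j) * i) % d                ≡⟨ cong (_% d) (rearrange a j i) ⟩
  (j * (a * i)) % d                ≡⟨ %-distribˡ-* j (a * i) d ⟩
  ((j % d) * ((a * i) % d)) % d    ≡⟨ cong (λ z → ((j % d) * z) % d) inv ⟩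
  ((j % d) * (1 % d)) % d          ≡⟨ %-distribˡ-* j 1 d ⟨
  (j * 1) % d                      ≡⟨ cong (_% d) (*-identityʳ j) ⟩
  j % d                            ≡⟨ m<n⇒m%n≡m j<d ⟩
  j                                ∎
  where
  rearrange : ∀ a j i → (a * j) * i ≡ j * (a * i)
  rearrange = solve-∀

coprime⇒generates : ∀ {i} d .{{_ : NonZero d}} → Coprime i d → ∀ {j} → j < d → ∃ λ c → (c * i) % d ≡ j
coprime⇒generates d i⊥d {j} j<d =
  let a , inv = coprime⇒invertible d i⊥d in a * j , invertible⇒generates {a} d inv j<d

-- Instance search cannot find NonZero (2 ^ t) for a variable t, so the modulus carries it here.
infixl 7 _mod2^_
_mod2^_ : ℕ → ℕ → ℕ
x mod2^ t = (x % 2 ^ t) {{m^n≢0 2 t}}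

double-multiple : ∀ t c q {r} → c * q mod2^ t ≡ r → c * (2 * q) mod2^ suc t ≡ 2 * r
double-multiple t c q refl = begin
  c * (2 * q) % 2 ^ suc t                ≡⟨ cong (_% 2 ^ suc t) (doubled (m≡m%n+[m/n]*n (c * q) (2 ^ t))) ⟩
  (2 * r + k * 2 ^ suc t) % 2 ^ suc t    ≡⟨ [m+kn]%n≡m%n (2 * r) k (2 ^ suc t) ⟩
  2 * r % 2 ^ suc t                      ≡⟨ m<n⇒m%n≡m (*-monoʳ-< 2 (m%n<n (c * q) (2 ^ t))) ⟩
  2 * r                                  ∎
  where
  instance
    _ = m^n≢0 2 t
    _ = m^n≢0 2 (suc t)
  r k : ℕ
  r = c * q % 2 ^ t
  k = c * q / 2 ^ t
  doubled : c * q ≡ r + k * 2 ^ t → c * (2 * q) ≡ 2 * r + k * 2 ^ suc t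
  doubled eq = begin
    c * (2 * q)          ≡⟨ swap c q ⟩
    2 * (c * q)          ≡⟨ cong (2 *_) eq ⟩
    2 * (r + k * 2 ^ t)  ≡⟨ spread r k (2 ^ t) ⟩
    2 * r + k * 2 ^ suc t ∎
    where
    swap : ∀ c q → c * (2 * q) ≡ 2 * (c * q)
    swap = solve-∀
    spread : ∀ r k d → 2 * (r + k * d) ≡ 2 * r + k * (2 * d)
    spread = solve-∀

multiples-chain : ∀ t {i j} → i < 2 ^ t → j < 2 ^ t →
  (∃ λ c → c * i mod2^ t ≡ j) ⊎ (∃ λ c → c * j mod2^ t ≡ i)
multiples-chain zero {zero} {zero} _ _ = inj₁ (0 , refl)
multiples-chain zero {suc _} (s≤s ())
multiples-chain zero {j = suc _} _ (s≤s ())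
multiples-chain (suc t) {i} {j} i< j< = by-parity (even-or-odd i) (even-or-odd j)
  where
  instance
    _ = m^n≢0 2 t
    _ = m^n≢0 2 (suc t)
  by-parity : (∃ λ q → i ≡ 2 * q) ⊎ (∃ λ q → i ≡ suc (2 * q)) →
              (∃ λ q → j ≡ 2 * q) ⊎ (∃ λ q → j ≡ suc (2 * q)) →
    (∃ λ c → c * i mod2^ suc t ≡ j) ⊎ (∃ λ c → c * j mod2^ suc t ≡ i)
  by-parity (inj₂ (q , refl)) _ = inj₁ (coprime⇒generates (2 ^ suc t) (odd-coprime-2^ q (suc t)) j<)
  by-parity (inj₁ _) (inj₂ (q , refl)) = inj₂ (coprime⇒generates (2 ^ suc t) (odd-coprime-2^ q (suc t)) i<)
  by-parity (inj₁ (q , refl)) (inj₁ (r , refl)) =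
    ⊎-map (λ (c , eq) → c , double-multiple t c q eq) (λ (c , eq) → c , double-multiple t c r eq)
      (multiples-chain t (*-cancelˡ-< 2 q (2 ^ t) i<) (*-cancelˡ-< 2 r (2 ^ t) j<))

suc[m∸2]≡m∸1 : ∀ {x} → 2 ≤ x → suc (x ∸ 2) ≡ x ∸ 1
suc[m∸2]≡m∸1 (s≤s (s≤s _)) = refl

[m∸1]+[m∸1]≡m+m∸2 : ∀ {x} → 1 ≤ x → (x ∸ 1) + (x ∸ 1) ≡ x + x ∸ 2
[m∸1]+[m∸1]≡m+m∸2 {suc x} _ = sym (cong (_∸ 1) (+-suc x x))

∈-++-skip : ∀ {A : Set} {x y : A} as bs → y ∈ as ++ x ∷ bs → y ≢ x → y ∈ as ++ bs
∈-++-skip as bs y∈ y≢x with ∈-++⁻ as y∈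
... | inj₁ y∈as = ∈-++⁺ˡ y∈as
... | inj₂ (here y≡x) = ⊥-elim (y≢x y≡x)
... | inj₂ (there y∈bs) = ∈-++⁺ʳ as y∈bs

unique⊆⇒length≤ : ∀ {A : Set} {xs ys : List A} → Unique xs → xs ⊆ ys → length xs ≤ length ys
unique⊆⇒length≤ [] _ = z≤n
unique⊆⇒length≤ {xs = x ∷ xs} x∷xs!@(_ ∷ xs!) x∷xs⊆ys with ∈-∃++ (x∷xs⊆ys (here refl))
... | as , bs , refl =
  subst (suc (length xs) ≤_) (sym (length-++-sucʳ as x bs)) (s≤s (unique⊆⇒length≤ xs! xs⊆as++bs))
  where
  xs⊆as++bs : xs ⊆ as ++ bs
  xs⊆as++bs y∈xs = ∈-++-skip as bs (x∷xs⊆ys (there y∈xs)) λ { refl → Unique[x∷xs]⇒x∉xs x∷xs! y∈xs }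

lastOf-∈ : ∀ x y ys → lastOf x (y ∷ ys) ∈ y ∷ ys
lastOf-∈ x y [] = here refl
lastOf-∈ x y (z ∷ zs) = there (lastOf-∈ y z zs)

lastOf-++ : ∀ x xs y ys → lastOf x (xs ++ y ∷ ys) ≡ lastOf y ys
lastOf-++ x [] y ys = refl
lastOf-++ x (z ∷ zs) y ys = lastOf-++ z zs y ys

linked-++ : ∀ {R : ℕ → ℕ → Set} {x xs y ys} →
  Linked R (x ∷ xs) → R (lastOf x xs) y → Linked R (y ∷ ys) → Linked R (x ∷ xs ++ y ∷ ys)
linked-++ {xs = []} [-] r ys↝ = r ∷ ys↝
linked-++ {xs = _ ∷ _} (r′ ∷ xs↝) r ys↝ = r′ ∷ linked-++ xs↝ r ys↝

applyUpTo-++ : ∀ {A : Set} (f : ℕ → A) a b → applyUpTo f (a + b) ≡ applyUpTo f a ++ applyUpTo (λ i → f (a + i)) b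
applyUpTo-++ f zero b = refl
applyUpTo-++ f (suc a) b = cong (f 0 ∷_) (applyUpTo-++ (λ i → f (suc i)) a b)

applyUpTo-constant : ∀ {A : Set} (f : ℕ → A) l {x} → (∀ {i} → i < l → f i ≡ x) → applyUpTo f l ≡ replicate l x
applyUpTo-constant f zero _ = refl
applyUpTo-constant f (suc l) f≡x =
  cong₂ _∷_ (f≡x z<s) (applyUpTo-constant (λ i → f (suc i)) l (λ i<l → f≡x (s<s i<l)))

applyUpTo-cong : ∀ {A : Set} {f g : ℕ → A} l → (∀ i → f i ≡ g i) → applyUpTo f l ≡ applyUpTo g l
applyUpTo-cong zero _ = refl
applyUpTo-cong (suc l) f≗g = cong₂ _∷_ (f≗g 0) (applyUpTo-cong l (λ i → f≗g (suc i)))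

applyUpTo-shape : ∀ {A : Set} (f : ℕ → A) a r b {v l xs ys x} → a + r ≡ v → v + b ≡ l →
  applyUpTo f a ≡ xs → (∀ {i} → a ≤ i → i < v → f i ≡ x) → applyUpTo (λ i → f (i + v)) b ≡ ys →
  applyUpTo f l ≡ xs ++ replicate r x ++ ys
applyUpTo-shape f a r b {x = x} refl refl refl f≡x refl = begin
  applyUpTo f (a + r + b)
    ≡⟨ applyUpTo-++ f (a + r) b ⟩
  applyUpTo f (a + r) ++ applyUpTo (λ i → f (a + r + i)) b
    ≡⟨ cong₂ _++_ (applyUpTo-++ f a r) (applyUpTo-cong b (λ i → cong f (+-comm (a + r) i))) ⟩
  (applyUpTo f a ++ applyUpTo (λ i → f (a + i)) r) ++ applyUpTo (λ i → f (i + (a + r))) b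
    ≡⟨ ++-assoc (applyUpTo f a) _ _ ⟩
  applyUpTo f a ++ applyUpTo (λ i → f (a + i)) r ++ applyUpTo (λ i → f (i + (a + r))) b
    ≡⟨ cong (λ zs → applyUpTo f a ++ zs ++ _)
            (applyUpTo-constant (λ i → f (a + i)) r (λ i<r → f≡x (m≤m+n a _) (+-monoʳ-< a i<r))) ⟩
  applyUpTo f a ++ replicate r x ++ applyUpTo (λ i → f (i + (a + r))) b
    ∎

-- Counting and distance degree sequences

count : (ℕ → ℕ) → ℕ → List ℕ → ℕ
count δ k xs = length (filter (λ v → δ v ≟ k) xs)

ifEq : ℕ → ℕ → ℕ → ℕ
ifEq c k l = if does (c ≟ k) then l else 0

ifEq-refl : ∀ k l → ifEq k k l ≡ l
ifEq-refl k l rewrite dec-true (k ≟ k) refl = refl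

ifEq-≢ : ∀ {c k} l → c ≢ k → ifEq c k l ≡ 0
ifEq-≢ {c} {k} l c≢k rewrite dec-false (c ≟ k) c≢k = refl

ifEq-zero : ∀ c k → ifEq c k 0 ≡ 0
ifEq-zero c k with does (c ≟ k)
... | true = refl
... | false = refl

ifEq-+ : ∀ c k a b → ifEq c k a + ifEq c k b ≡ ifEq c k (a + b)
ifEq-+ c k a b with does (c ≟ k)
... | true = refl
... | false = refl

count-++ : ∀ δ k xs ys → count δ k (xs ++ ys) ≡ count δ k xs + count δ k ys
count-++ δ k xs ys = trans (cong length (filter-++ (λ v → δ v ≟ k) xs ys)) (length-++ (filter (λ v → δ v ≟ k) xs))

count-∷ : ∀ δ k x xs → count δ k (x ∷ xs) ≡ ifEq (δ x) k 1 + count δ k xs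
count-∷ δ k x xs with does (δ x ≟ k)
... | true = refl
... | false = refl

count-upTo-suc : ∀ δ k b → count δ k (upTo (suc b)) ≡ count δ k (upTo b) + ifEq (δ b) k 1
count-upTo-suc δ k b = begin
  count δ k (upTo (suc b))                     ≡⟨ cong (count δ k) (upTo-∷ʳ b) ⟨
  count δ k (upTo b ++ b ∷ [])                 ≡⟨ count-++ δ k (upTo b) (b ∷ []) ⟩
  count δ k (upTo b) + count δ k (b ∷ [])      ≡⟨ cong (count δ k (upTo b) +_) (trans (count-∷ δ k b []) (+-identityʳ _)) ⟩
  count δ k (upTo b) + ifEq (δ b) k 1          ∎

count-upTo-extend : ∀ δ k a l {b c} → a + l ≡ b → (∀ {i} → a ≤ i → i < b → δ i ≡ c) →
  count δ k (upTo b) ≡ count δ k (upTo a) + ifEq c k l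
count-upTo-extend δ k a zero {c = c} refl _ = begin
  count δ k (upTo (a + 0))          ≡⟨ cong (count δ k ∘ upTo) (+-identityʳ a) ⟩
  count δ k (upTo a)                ≡⟨ +-identityʳ _ ⟨
  count δ k (upTo a) + 0            ≡⟨ cong (count δ k (upTo a) +_) (ifEq-zero c k) ⟨
  count δ k (upTo a) + ifEq c k 0   ∎
count-upTo-extend δ k a (suc l) {c = c} refl δ≡c = begin
  count δ k (upTo (a + suc l))                      ≡⟨ cong (count δ k ∘ upTo) (+-suc a l) ⟩
  count δ k (upTo (suc (a + l)))                    ≡⟨ count-upTo-suc δ k (a + l) ⟩
  count δ k (upTo (a + l)) + ifEq (δ (a + l)) k 1
    ≡⟨ cong₂ _+_ (count-upTo-extend δ k a l refl earlier) (cong (λ d → ifEq d k 1) last≡c) ⟩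
  count δ k (upTo a) + ifEq c k l + ifEq c k 1      ≡⟨ +-assoc (count δ k (upTo a)) _ _ ⟩
  count δ k (upTo a) + (ifEq c k l + ifEq c k 1)    ≡⟨ cong (count δ k (upTo a) +_) (ifEq-+ c k l 1) ⟩
  count δ k (upTo a) + ifEq c k (l + 1)             ≡⟨ cong (λ x → count δ k (upTo a) + ifEq c k x) (+-comm l 1) ⟩
  count δ k (upTo a) + ifEq c k (suc l)             ∎
  where
  earlier : ∀ {i} → a ≤ i → i < a + l → δ i ≡ c
  earlier {i} a≤i i< = δ≡c a≤i (subst (i <_) (sym (+-suc a l)) (m<n⇒m<1+n i<))
  last≡c : δ (a + l) ≡ c
  last≡c = δ≡c (m≤m+n a l) (subst (a + l <_) (sym (+-suc a l)) ≤-refl)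

hasCount-count : ∀ {n} {P : ℕ → Set} δ k →
  (∀ {v} → Vertex n v → P v → δ v ≡ k) → (∀ {v} → Vertex n v → δ v ≡ k → P v) →
  HasCount n P (count δ k (upTo (2 ^ n)))
hasCount-count {n} δ k P⇒ ⇒P = filter δ≟k (upTo (2 ^ n)) , filter⁺ δ≟k (upTo⁺ (2 ^ n)) , refl ,
  λ v → (λ v∈ → let v∈upTo , δv≡k = ∈-filter⁻ δ≟k v∈ in ∈-upTo⁻ v∈upTo , ⇒P (∈-upTo⁻ v∈upTo) δv≡k) ,
        (λ (v<2^n , Pv) → ∈-filter⁺ δ≟k (∈-upTo⁺ v<2^n) (P⇒ v<2^n Pv))
  where
  δ≟k : (v : ℕ) → Dec (δ v ≡ k)
  δ≟k v = δ v ≟ k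

Dist-functional : ∀ {n u v a b} → Dist n u v a → Dist n u v b → a ≡ b
Dist-functional (path-a , shortest-a) (path-b , shortest-b) = ≤-antisym (shortest-a _ path-b) (shortest-b _ path-a)

Detour-functional : ∀ {n u v a b} → Detour n u v a → Detour n u v b → a ≡ b
Detour-functional (path-a , longest-a) (path-b , longest-b) = ≤-antisym (longest-b _ path-a) (longest-a _ path-b)

DDSwrt-intro : ∀ (D : ℕ → ℕ → ℕ → ℕ → Set) {n u} (δ c : ℕ → ℕ) e →
  (∀ {v a b} → D n u v a → D n u v b → a ≡ b) →
  (∀ {v} → Vertex n v → D n u v (δ v)) →
  (∀ k → count δ k (upTo (2 ^ n)) ≡ c k) →
  (∀ {v} → Vertex n v → δ v ≤ e) →
  ∀ {w} → Vertex n w → δ w ≡ e →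
  DDSwrt D n u (applyUpTo c (suc e))
DDSwrt-intro D {n} {u} δ c e D-functional D-δ count≡c δ≤e {w} w<2^n δw≡e =
  e , (λ v v<2^n → δ v , δ≤e v<2^n , D-δ v<2^n) , (w , w<2^n , subst (D n u w) δw≡e (D-δ w<2^n)) ,
  length-applyUpTo c (suc e) ,
  λ i → subst (HasCount n (λ v → D n u v (toℕ i))) (trans (count≡c (toℕ i)) (sym (lookup-applyUpTo c (suc e) i)))
          (hasCount-count {n} δ (toℕ i) (λ v<2^n Dv → D-functional (D-δ v<2^n) Dv)
                                        (λ v<2^n δv≡i → subst (D n u _) δv≡i (D-δ v<2^n)))

-- The gyrogroup G(n) and its power graph

CliqueStar : ℕ → ℕ → ℕ → Set
CliqueStar M u v = (u < M × v < M) ⊎ (u ≡ 0 × M ≤ v) ⊎ (M ≤ u × v ≡ 0)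

module Gyrogroup (k : ℕ) where
  n M N : ℕ
  n = suc (suc k)
  M = m n
  N = 2 ^ n

  instance
    M≢0 : NonZero M
    M≢0 = m^n≢0 2 (suc k)

  N≡M+M : N ≡ M + M
  N≡M+M = cong (M +_) (+-identityʳ M)

  half≡2^k : half n ≡ 2 ^ k
  half≡2^k = trans (cong (_/ 2) (*-comm 2 (2 ^ k))) (m*n/n≡m (2 ^ k) 2)

  op-pure-pure : ∀ {i j} → i < M → j < M → op n i j ≡ (i + j) % M
  op-pure-pure {i} {j} i<M j<M with i <? M | j <? M
  ... | yes _ | yes _ = refl
  ... | no i≮M | _ = ⊥-elim (i≮M i<M)
  ... | yes _ | no j≮M = ⊥-elim (j≮M j<M)

  op-hyper-pure : ∀ {i j} → M ≤ i → j < M → op n i j ≡ (i + (half n ∸ 1) * j) % M + M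
  op-hyper-pure {i} {j} M≤i j<M with i <? M | j <? M
  ... | no _ | yes _ = refl
  ... | yes i<M | _ = ⊥-elim (<⇒≱ i<M M≤i)
  ... | no _ | no j≮M = ⊥-elim (j≮M j<M)

  op-hyper-hyper : ∀ {i j} → M ≤ i → M ≤ j → op n i j ≡ ((half n + 1) * i + (half n ∸ 1) * j) % M
  op-hyper-hyper {i} {j} M≤i M≤j with i <? M | j <? M
  ... | no _ | no _ = refl
  ... | yes i<M | _ = ⊥-elim (<⇒≱ i<M M≤i)
  ... | no _ | yes j<M = ⊥-elim (<⇒≱ j<M M≤j)

  op-hyper-self : ∀ {h} → M ≤ h → op n h h ≡ 0
  op-hyper-self {h} M≤h = begin
    op n h h                                        ≡⟨ op-hyper-hyper M≤h M≤h ⟩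
    ((half n + 1) * h + (half n ∸ 1) * h) % M       ≡⟨ cong (_% M) (*-distribʳ-+ h (half n + 1) (half n ∸ 1)) ⟨
    (((half n + 1) + (half n ∸ 1)) * h) % M         ≡⟨ cong (λ x → (x * h) % M) coefficients ⟩
    (M * h) % M                                     ≡⟨ cong (_% M) (*-comm M h) ⟩
    (h * M) % M                                     ≡⟨ m*n%n≡0 h M ⟩
    0                                               ∎
    where
    coefficients : (half n + 1) + (half n ∸ 1) ≡ M
    coefficients = begin
      (half n + 1) + (half n ∸ 1)   ≡⟨ +-assoc (half n) 1 (half n ∸ 1) ⟩
      half n + (1 + (half n ∸ 1))   ≡⟨ cong (half n +_) (m+[n∸m]≡n 1≤half) ⟩
      half n + half n               ≡⟨ cong₂ _+_ half≡2^k half≡2^k ⟩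
      2 ^ k + 2 ^ k                 ≡⟨ cong (2 ^ k +_) (+-identityʳ (2 ^ k)) ⟨
      M                             ∎
      where
      1≤half : 1 ≤ half n
      1≤half = subst (1 ≤_) (sym half≡2^k) (m^n>0 2 k)

  op-hyper-zero : ∀ {h} → M ≤ h → h < N → op n h 0 ≡ h
  op-hyper-zero {h} M≤h h<N = begin
    op n h 0                               ≡⟨ op-hyper-pure M≤h (m^n>0 2 (suc k)) ⟩
    (h + (half n ∸ 1) * 0) % M + M         ≡⟨ cong (λ x → (h + x) % M + M) (*-zeroʳ (half n ∸ 1)) ⟩
    (h + 0) % M + M                        ≡⟨ cong (λ x → x % M + M) (+-identityʳ h) ⟩
    h % M + M                              ≡⟨ cong (_+ M) (m≤n⇒[n∸m]%m≡n%m M≤h) ⟨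
    (h ∸ M) % M + M                        ≡⟨ cong (_+ M) (m<n⇒m%n≡m h∸M<M) ⟩
    h ∸ M + M                              ≡⟨ m∸n+n≡m M≤h ⟩
    h                                      ∎
    where
    h∸M<M : h ∸ M < M
    h∸M<M = subst (h ∸ M <_) (m+n∸m≡n M M) (∸-monoˡ-< (subst (h <_) N≡M+M h<N) M≤h)

  power-pure : ∀ {u} → u < M → ∀ j → power n u (suc j) ≡ (suc j * u) % M
  power-pure {u} u<M zero = begin
    u                ≡⟨ m<n⇒m%n≡m u<M ⟨
    u % M            ≡⟨ cong (_% M) (+-identityʳ u) ⟨
    (u + 0) % M      ∎
  power-pure {u} u<M (suc j) = begin
    op n u (power n u (suc j))              ≡⟨ cong (op n u) (power-pure u<M j) ⟩
    op n u ((suc j * u) % M)                ≡⟨ op-pure-pure u<M (m%n<n (suc j * u) M) ⟩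
    (u + (suc j * u) % M) % M               ≡⟨ %-distribˡ-+ u ((suc j * u) % M) M ⟩
    (u % M + (suc j * u) % M % M) % M       ≡⟨ cong (λ x → (u % M + x) % M) (m%n%n≡m%n (suc j * u) M) ⟩
    (u % M + (suc j * u) % M) % M           ≡⟨ %-distribˡ-+ u (suc j * u) M ⟨
    (suc (suc j) * u) % M                   ∎

  power-hyper : ∀ {h} → M ≤ h → h < N → ∀ j → power n h (suc j) ≡ h ⊎ power n h (suc j) ≡ 0
  power-hyper M≤h h<N zero = inj₁ refl
  power-hyper {h} M≤h h<N (suc j) with power-hyper M≤h h<N j
  ... | inj₁ p≡h = inj₂ (trans (cong (op n h) p≡h) (op-hyper-self M≤h))
  ... | inj₂ p≡0 = inj₁ (trans (cong (op n h) p≡0) (op-hyper-zero M≤h h<N))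

  -- The exponent c + m acts as c on P(n) and is positive even when c = 0.
  power-reaches-multiples : ∀ {u} → u < M → ∀ c → power n u (suc (c + (M ∸ 1))) ≡ (c * u) % M
  power-reaches-multiples {u} u<M c = begin
    power n u (suc (c + (M ∸ 1)))     ≡⟨ power-pure u<M (c + (M ∸ 1)) ⟩
    (suc (c + (M ∸ 1)) * u) % M       ≡⟨ cong (λ x → (x * u) % M) (trans (sym (+-suc c (M ∸ 1))) (cong (c +_) (suc-pred M))) ⟩
    ((c + M) * u) % M                 ≡⟨ cong (_% M) (trans (*-distribʳ-+ u c M) (cong (c * u +_) (*-comm M u))) ⟩
    (c * u + u * M) % M               ≡⟨ [m+kn]%n≡m%n (c * u) u M ⟩
    (c * u) % M                       ∎

  distinct-power-cases : ∀ {u v} → u < N → u ≢ v → (∃ λ j → power n u (suc j) ≡ v) →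
    (u < M × v < M) ⊎ (M ≤ u × v ≡ 0)
  distinct-power-cases {u} u<N u≢v (j , refl) with u <? M
  ... | yes u<M = inj₁ (u<M , subst (_< M) (sym (power-pure u<M j)) (m%n<n (suc j * u) M))
  ... | no u≮M with power-hyper (≮⇒≥ u≮M) u<N j
  ...   | inj₁ p≡u = ⊥-elim (u≢v (sym p≡u))
  ...   | inj₂ p≡0 = inj₂ (≮⇒≥ u≮M , p≡0)

  adjacent⇒cliqueStar : ∀ {u v} → Adj n u v → CliqueStar M u v
  adjacent⇒cliqueStar (u<N , v<N , u≢v , inj₁ u⇝v) with distinct-power-cases u<N u≢v u⇝v
  ... | inj₁ both<M = inj₁ both<M
  ... | inj₂ (M≤u , v≡0) = inj₂ (inj₂ (M≤u , v≡0))
  adjacent⇒cliqueStar (u<N , v<N , u≢v , inj₂ v⇝u) with distinct-power-cases v<N (u≢v ∘ sym) v⇝u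
  ... | inj₁ (v<M , u<M) = inj₁ (u<M , v<M)
  ... | inj₂ (M≤v , u≡0) = inj₂ (inj₁ (u≡0 , M≤v))

  cliqueStar⇒adjacent : ∀ {u v} → u < N → v < N → u ≢ v → CliqueStar M u v → Adj n u v
  cliqueStar⇒adjacent u<N v<N u≢v (inj₁ (u<M , v<M)) with multiples-chain (suc k) u<M v<M
  ... | inj₁ (c , cu≡v) = u<N , v<N , u≢v , inj₁ (c + (M ∸ 1) , trans (power-reaches-multiples u<M c) cu≡v)
  ... | inj₂ (c , cv≡u) = u<N , v<N , u≢v , inj₂ (c + (M ∸ 1) , trans (power-reaches-multiples v<M c) cv≡u)
  cliqueStar⇒adjacent u<N v<N u≢v (inj₂ (inj₁ (refl , M≤v))) = u<N , v<N , u≢v , inj₂ (1 , op-hyper-self M≤v)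
  cliqueStar⇒adjacent u<N v<N u≢v (inj₂ (inj₂ (M≤u , refl))) = u<N , v<N , u≢v , inj₁ (1 , op-hyper-self M≤u)

-- Distances in a clique with a star attached

-- pure and hyper refer to the halves P(n) = [0, m) and H(n) = [m, 2m) of G(n).
data Kind : Set where
  origin pure hyper : Kind

data Role : Set where
  self origin pure hyper : Role

module PowerGraph
  (n : ℕ)
  (N≡M+M : 2 ^ n ≡ m n + m n)
  (4≤M : 4 ≤ m n)
  (adj⇒ : ∀ {u v} → Adj n u v → CliqueStar (m n) u v)
  (adj⇐ : ∀ {u v} → Vertex n u → Vertex n v → u ≢ v → CliqueStar (m n) u v → Adj n u v)
  where

  M N : ℕ
  M = m n
  N = 2 ^ n

  0<M : 0 < M
  0<M = ≤-trans (s≤s z≤n) 4≤M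

  1<M : 1 < M
  1<M = ≤-trans (s≤s (s≤s z≤n)) 4≤M

  2<M : 2 < M
  2<M = ≤-trans (s≤s (s≤s (s≤s z≤n))) 4≤M

  suc[M∸1]≡M : suc (M ∸ 1) ≡ M
  suc[M∸1]≡M = m+[n∸m]≡n 0<M

  M∸1<M : M ∸ 1 < M
  M∸1<M = ≤-reflexive suc[M∸1]≡M

  1<M∸1 : 1 < M ∸ 1
  1<M∸1 = ∸-monoˡ-≤ 1 2<M

  M∸1≢0 : M ∸ 1 ≢ 0
  M∸1≢0 = >⇒≢ (<-trans z<s 1<M∸1)

  M∸1≢1 : M ∸ 1 ≢ 1
  M∸1≢1 = >⇒≢ 1<M∸1

  M<N : M < N
  M<N = subst (M <_) (sym N≡M+M) (m<m+n M 0<M)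

  pure⇒vertex : ∀ {v} → v < M → v < N
  pure⇒vertex {v} v<M = subst (v <_) (sym N≡M+M) (≤-trans v<M (m≤m+n M M))

  hyper⇒≢0 : ∀ {v} → M ≤ v → v ≢ 0
  hyper⇒≢0 M≤v refl = <⇒≱ 0<M M≤v

  adjacent-pure : ∀ {u v} → u < M → v < M → u ≢ v → Adj n u v
  adjacent-pure u<M v<M u≢v = adj⇐ (pure⇒vertex u<M) (pure⇒vertex v<M) u≢v (inj₁ (u<M , v<M))

  adjacent-origin-hyper : ∀ {v} → M ≤ v → v < N → Adj n 0 v
  adjacent-origin-hyper M≤v v<N = adj⇐ (pure⇒vertex 0<M) v<N (hyper⇒≢0 M≤v ∘ sym) (inj₂ (inj₁ (refl , M≤v)))

  adjacent-hyper-origin : ∀ {u} → M ≤ u → u < N → Adj n u 0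
  adjacent-hyper-origin M≤u u<N = adj⇐ u<N (pure⇒vertex 0<M) (hyper⇒≢0 M≤u) (inj₂ (inj₂ (M≤u , refl)))

  cliqueStar-hyperˡ : ∀ {u v} → M ≤ u → CliqueStar M u v → v ≡ 0
  cliqueStar-hyperˡ M≤u (inj₁ (u<M , _)) = ⊥-elim (<⇒≱ u<M M≤u)
  cliqueStar-hyperˡ M≤u (inj₂ (inj₁ (u≡0 , _))) = ⊥-elim (hyper⇒≢0 M≤u u≡0)
  cliqueStar-hyperˡ M≤u (inj₂ (inj₂ (_ , v≡0))) = v≡0

  cliqueStar-hyperʳ : ∀ {u v} → M ≤ v → CliqueStar M u v → u ≡ 0
  cliqueStar-hyperʳ M≤v (inj₁ (_ , v<M)) = ⊥-elim (<⇒≱ v<M M≤v)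
  cliqueStar-hyperʳ M≤v (inj₂ (inj₁ (u≡0 , _))) = u≡0
  cliqueStar-hyperʳ M≤v (inj₂ (inj₂ (_ , v≡0))) = ⊥-elim (hyper⇒≢0 M≤v v≡0)

  path-refl : ∀ {u} → Vertex n u → PathLen n u u 0
  path-refl u<N = [] , u<N , [-] , [] ∷ [] , refl , refl

  path-edge : ∀ {u v} → Adj n u v → PathLen n u v 1
  path-edge adj@(u<N , _ , u≢v , _) = _ ∷ [] , u<N , adj ∷ [-] , (u≢v ∷ []) ∷ [] ∷ [] , refl , refl

  path-two : ∀ {u w v} → Adj n u w → Adj n w v → u ≢ v → PathLen n u v 2
  path-two adj₁@(u<N , _ , u≢w , _) adj₂@(_ , _ , w≢v , _) u≢v =
    _ ∷ _ ∷ [] , u<N , adj₁ ∷ adj₂ ∷ [-] , (u≢w ∷ u≢v ∷ []) ∷ (w≢v ∷ []) ∷ [] ∷ [] , refl , refl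

  path-to-self-length : ∀ {u j} → PathLen n u u j → j ≡ 0
  path-to-self-length ([] , _ , _ , _ , _ , refl) = refl
  path-to-self-length {u} (y ∷ ys , _ , _ , u∷ys! , last≡u , refl) =
    ⊥-elim (Unique[x∷xs]⇒x∉xs u∷ys! (subst (_∈ y ∷ ys) last≡u (lastOf-∈ u y ys)))

  path-length-≥1 : ∀ {u v j} → u ≢ v → PathLen n u v j → 1 ≤ j
  path-length-≥1 u≢v ([] , _ , _ , _ , u≡v , _) = ⊥-elim (u≢v u≡v)
  path-length-≥1 u≢v (_ ∷ _ , _ , _ , _ , _ , refl) = s≤s z≤n

  path-length-≥2 : ∀ {u v j} → u ≢ v → ¬ CliqueStar M u v → PathLen n u v j → 2 ≤ j
  path-length-≥2 u≢v _ ([] , _ , _ , _ , u≡v , _) = ⊥-elim (u≢v u≡v)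
  path-length-≥2 _ ¬uv (_ ∷ [] , _ , adj ∷ [-] , _ , refl , refl) = ⊥-elim (¬uv (adj⇒ adj))
  path-length-≥2 _ _ (_ ∷ _ ∷ _ , _ , _ , _ , _ , refl) = s≤s (s≤s z≤n)

  -- A vertex of H(n) has 0 as its only neighbour, so it can only be an end of a path.
  path-interior : ∀ {x ys y} → Linked (Adj n) (x ∷ ys) → Unique (x ∷ ys) → y ∈ ys → y < M ⊎ y ≡ lastOf x ys
  path-interior {ys = y ∷ []} _ _ (here refl) = inj₂ refl
  path-interior {ys = y ∷ z ∷ zs} (x~y ∷ y~z ∷ _) ((_ ∷ x≢z ∷ _) ∷ _) (here refl) with y <? M
  ... | yes y<M = inj₁ y<M
  ... | no y≮M =
    ⊥-elim (x≢z (trans (cliqueStar-hyperʳ (≮⇒≥ y≮M) (adj⇒ x~y)) (sym (cliqueStar-hyperˡ (≮⇒≥ y≮M) (adj⇒ y~z)))))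
  path-interior {ys = y ∷ z ∷ zs} (_ ∷ ys↝) (_ ∷ ys!) (there y∈) = path-interior ys↝ ys! y∈

  path-pure-pure-< : ∀ {u v j} → u < M → v < M → PathLen n u v j → j < M
  path-pure-pure-< {u} {v} u<M v<M (ys , _ , ys↝ , ys! , last≡v , refl) =
    subst (suc (length ys) ≤_) (length-upTo M) (unique⊆⇒length≤ ys! ⊆upTo)
    where
    ⊆upTo : u ∷ ys ⊆ upTo M
    ⊆upTo (here refl) = ∈-upTo⁺ u<M
    ⊆upTo (there y∈) with path-interior ys↝ ys! y∈
    ... | inj₁ y<M = ∈-upTo⁺ y<M
    ... | inj₂ y≡last = ∈-upTo⁺ (subst (_< M) (sym (trans y≡last last≡v)) v<M)

  path-hyper-pure-≤ : ∀ {u v j} → M ≤ u → v < M → PathLen n u v j → j ≤ M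
  path-hyper-pure-≤ {u} {v} M≤u v<M (ys , _ , ys↝ , u∷ys!@(_ ∷ ys!) , last≡v , refl) =
    subst (length ys ≤_) (length-upTo M) (unique⊆⇒length≤ ys! ⊆upTo)
    where
    ⊆upTo : ys ⊆ upTo M
    ⊆upTo y∈ with path-interior ys↝ u∷ys! y∈
    ... | inj₁ y<M = ∈-upTo⁺ y<M
    ... | inj₂ y≡last = ∈-upTo⁺ (subst (_< M) (sym (trans y≡last last≡v)) v<M)

  path-pure-hyper-≤ : ∀ {u v j} → u < M → M ≤ v → PathLen n u v j → j ≤ M
  path-pure-hyper-≤ {u} {v} u<M M≤v (ys , _ , ys↝ , ys! , last≡v , refl) =
    ≤-pred (subst (suc (length ys) ≤_) (cong suc (length-upTo M)) (unique⊆⇒length≤ ys! ⊆v∷upTo))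
    where
    ⊆v∷upTo : u ∷ ys ⊆ v ∷ upTo M
    ⊆v∷upTo (here refl) = there (∈-upTo⁺ u<M)
    ⊆v∷upTo (there y∈) with path-interior ys↝ ys! y∈
    ... | inj₁ y<M = there (∈-upTo⁺ y<M)
    ... | inj₂ y≡last = here (trans y≡last last≡v)

  origin-before-hyper : ∀ {y z zs} → Linked (Adj n) (y ∷ z ∷ zs) → M ≤ lastOf y (z ∷ zs) → 0 ∈ y ∷ z ∷ zs
  origin-before-hyper {zs = []} (y~z ∷ [-]) M≤z = here (sym (cliqueStar-hyperʳ M≤z (adj⇒ y~z)))
  origin-before-hyper {zs = _ ∷ _} (_ ∷ zs↝) M≤last = there (origin-before-hyper zs↝ M≤last)

  path-origin-hyper-≤ : ∀ {v j} → M ≤ v → PathLen n 0 v j → j ≤ 1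
  path-origin-hyper-≤ _ ([] , _ , _ , _ , _ , refl) = z≤n
  path-origin-hyper-≤ _ (_ ∷ [] , _ , _ , _ , _ , refl) = s≤s z≤n
  path-origin-hyper-≤ M≤v (_ ∷ _ ∷ _ , _ , _ ∷ ys↝ , 0∷ys! , refl , refl) =
    ⊥-elim (Unique[x∷xs]⇒x∉xs 0∷ys! (origin-before-hyper ys↝ M≤v))

  path-hyper-origin-≤ : ∀ {u j} → M ≤ u → PathLen n u 0 j → j ≤ 1
  path-hyper-origin-≤ _ ([] , _ , _ , _ , _ , refl) = z≤n
  path-hyper-origin-≤ _ (_ ∷ [] , _ , _ , _ , _ , refl) = s≤s z≤n
  path-hyper-origin-≤ M≤u (y ∷ z ∷ zs , _ , u~y ∷ _ , _ ∷ ys! , last≡0 , refl) =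
    ⊥-elim (Unique[x∷xs]⇒x∉xs ys!
      (subst (_∈ z ∷ zs) (trans last≡0 (sym (cliqueStar-hyperˡ M≤u (adj⇒ u~y)))) (lastOf-∈ y z zs)))

  path-hyper-hyper-≤ : ∀ {u v j} → M ≤ u → M ≤ v → PathLen n u v j → j ≤ 2
  path-hyper-hyper-≤ _ _ ([] , _ , _ , _ , _ , refl) = z≤n
  path-hyper-hyper-≤ _ _ (_ ∷ [] , _ , _ , _ , _ , refl) = s≤s z≤n
  path-hyper-hyper-≤ _ _ (_ ∷ _ ∷ [] , _ , _ , _ , _ , refl) = s≤s (s≤s z≤n)
  path-hyper-hyper-≤ M≤u M≤v (y ∷ z ∷ w ∷ ws , _ , u~y ∷ _ ∷ zs↝ , _ ∷ ys! , refl , refl) =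
    ⊥-elim (Unique[x∷xs]⇒x∉xs ys!
      (subst (_∈ z ∷ w ∷ ws) (sym (cliqueStar-hyperˡ M≤u (adj⇒ u~y))) (origin-before-hyper zs↝ M≤v)))

  clique-linked : ∀ {xs} → Unique xs → All (_< M) xs → Linked (Adj n) xs
  clique-linked [] [] = []
  clique-linked (_ ∷ []) (_ ∷ []) = [-]
  clique-linked ((x≢y ∷ _) ∷ ys!) (x<M ∷ y<M ∷ ys<M) = adjacent-pure x<M y<M x≢y ∷ clique-linked ys! (y<M ∷ ys<M)

  HamiltonianPure : ℕ → ℕ → Set
  HamiltonianPure p q = ∃ λ ys →
    Linked (Adj n) (p ∷ ys) × Unique (p ∷ ys) × All (_< M) (p ∷ ys) × lastOf p ys ≡ q × length ys ≡ M ∸ 1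

  hamiltonian-pure : ∀ {p q} → p < M → q < M → p ≢ q → HamiltonianPure p q
  hamiltonian-pure {p} {q} p<M q<M p≢q =
    ys , clique-linked p∷ys! p∷ys<M , p∷ys! , p∷ys<M , lastOf-++ p others q [] , cong pred length≡M
    where
    keep? : (x : ℕ) → Dec (x ≢ p × x ≢ q)
    keep? x = ¬? (x ≟ p) ×-dec ¬? (x ≟ q)

    others ys : List ℕ
    others = filter keep? (upTo M)
    ys = others ++ q ∷ []

    ∈ys : ∀ {x} → x ∈ ys → x < M × p ≢ x
    ∈ys x∈ with ∈-++⁻ others x∈
    ... | inj₁ x∈others = let x∈upTo , x≢p , _ = ∈-filter⁻ keep? {xs = upTo M} x∈others
                           in ∈-upTo⁻ x∈upTo , x≢p ∘ sym
    ... | inj₂ (here refl) = q<M , p≢q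

    p∷ys! : Unique (p ∷ ys)
    p∷ys! = All.tabulate (proj₂ ∘ ∈ys) ∷ ++⁺ (filter⁺ keep? (upTo⁺ M)) ([] ∷ []) others∌q
      where
      others∌q : Disjoint others (q ∷ [])
      others∌q (x∈others , here refl) = proj₂ (proj₂ (∈-filter⁻ keep? {xs = upTo M} x∈others)) refl

    p∷ys<M : All (_< M) (p ∷ ys)
    p∷ys<M = p<M ∷ All.tabulate (proj₁ ∘ ∈ys)

    upTo⊆p∷ys : upTo M ⊆ p ∷ ys
    upTo⊆p∷ys {x} x∈upTo with x ≟ p | x ≟ q
    ... | yes refl | _ = here refl
    ... | no _ | yes refl = there (∈-++⁺ʳ others (here refl))
    ... | no x≢p | no x≢q = there (∈-++⁺ˡ (∈-filter⁺ keep? x∈upTo (x≢p , x≢q)))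

    length≡M : suc (length ys) ≡ M
    length≡M = ≤-antisym
      (subst (suc (length ys) ≤_) (length-upTo M) (unique⊆⇒length≤ p∷ys! (∈-upTo⁺ ∘ All.lookup p∷ys<M)))
      (subst (_≤ suc (length ys)) (length-upTo M) (unique⊆⇒length≤ (upTo⁺ M) upTo⊆p∷ys))

  dist-refl : ∀ {u} → Vertex n u → Dist n u u 0
  dist-refl u<N = path-refl u<N , λ _ _ → z≤n

  dist-adjacent : ∀ {u v} → Adj n u v → Dist n u v 1
  dist-adjacent adj@(_ , _ , u≢v , _) = path-edge adj , λ _ → path-length-≥1 u≢v

  dist-two : ∀ {u w v} → Adj n u w → Adj n w v → u ≢ v → ¬ CliqueStar M u v → Dist n u v 2
  dist-two u~w w~v u≢v ¬u~v = path-two u~w w~v u≢v , λ _ → path-length-≥2 u≢v ¬u~v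

  detour-refl : ∀ {u} → Vertex n u → Detour n u u 0
  detour-refl u<N = path-refl u<N , λ _ path → ≤-reflexive (path-to-self-length path)

  detour-pure-pure : ∀ {p q} → p < M → q < M → p ≢ q → Detour n p q (M ∸ 1)
  detour-pure-pure p<M q<M p≢q =
    let ys , ys↝ , ys! , _ , last≡q , length≡ = hamiltonian-pure p<M q<M p≢q
    in (ys , pure⇒vertex p<M , ys↝ , ys! , last≡q , length≡) , λ _ path → <⇒≤pred (path-pure-pure-< p<M q<M path)

  detour-pure-hyper : ∀ {p h} → p < M → p ≢ 0 → M ≤ h → h < N → Detour n p h M
  detour-pure-hyper {p} {h} p<M p≢0 M≤h h<N =
    let ys , ys↝ , ys! , ys<M , last≡0 , length≡ = hamiltonian-pure p<M 0<M p≢0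
    in (ys ++ h ∷ [] , pure⇒vertex p<M ,
        linked-++ ys↝ (subst (λ x → Adj n x h) (sym last≡0) (adjacent-origin-hyper M≤h h<N)) [-] ,
        ++⁺ ys! ([] ∷ []) (λ { (h∈ , here refl) → <⇒≱ (All.lookup ys<M h∈) M≤h }) ,
        lastOf-++ p ys h [] ,
        trans (trans (length-++ ys) (+-comm (length ys) 1)) (trans (cong suc length≡) suc[M∸1]≡M)) ,
       λ _ path → path-pure-hyper-≤ p<M M≤h path

  detour-hyper-pure : ∀ {p h} → p < M → p ≢ 0 → M ≤ h → h < N → Detour n h p M
  detour-hyper-pure p<M p≢0 M≤h h<N =
    let ys , ys↝ , ys! , ys<M , last≡p , length≡ = hamiltonian-pure 0<M p<M (p≢0 ∘ sym)
    in (0 ∷ ys , h<N , adjacent-hyper-origin M≤h h<N ∷ ys↝ ,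
        All.map (λ x<M h≡x → <⇒≱ x<M (subst (M ≤_) h≡x M≤h)) ys<M ∷ ys! , last≡p ,
        trans (cong suc length≡) suc[M∸1]≡M) ,
       λ _ path → path-hyper-pure-≤ M≤h p<M path

  detour-origin-hyper : ∀ {h} → M ≤ h → h < N → Detour n 0 h 1
  detour-origin-hyper M≤h h<N = path-edge (adjacent-origin-hyper M≤h h<N) , λ _ → path-origin-hyper-≤ M≤h

  detour-hyper-origin : ∀ {h} → M ≤ h → h < N → Detour n h 0 1
  detour-hyper-origin M≤h h<N = path-edge (adjacent-hyper-origin M≤h h<N) , λ _ → path-hyper-origin-≤ M≤h

  detour-hyper-hyper : ∀ {h h′} → M ≤ h → h < N → M ≤ h′ → h′ < N → h ≢ h′ → Detour n h h′ 2
  detour-hyper-hyper M≤h h<N M≤h′ h′<N h≢h′ =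
    path-two (adjacent-hyper-origin M≤h h<N) (adjacent-origin-hyper M≤h′ h′<N) h≢h′ ,
    λ _ → path-hyper-hyper-≤ M≤h M≤h′

  kind : ℕ → Kind
  kind u = if does (u ≟ 0) then origin else if does (u <? M) then pure else hyper

  role : ℕ → ℕ → Role
  role u v = if does (v ≟ u) then self else if does (v ≟ 0) then origin else if does (v <? M) then pure else hyper

  kind-pure : ∀ {u} → u ≢ 0 → u < M → kind u ≡ pure
  kind-pure {u} u≢0 u<M rewrite dec-false (u ≟ 0) u≢0 | dec-true (u <? M) u<M = refl

  kind-hyper : ∀ {u} → M ≤ u → kind u ≡ hyper
  kind-hyper {u} M≤u rewrite dec-false (u ≟ 0) (hyper⇒≢0 M≤u) | dec-false (u <? M) (≤⇒≯ M≤u) = refl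

  role-self : ∀ {u} → role u u ≡ self
  role-self {u} rewrite dec-true (u ≟ u) refl = refl

  role-self-block : ∀ {u i} → u ≤ i → i < suc u → role u i ≡ self
  role-self-block {u} u≤i (s≤s i≤u) = subst (λ x → role u x ≡ self) (≤-antisym u≤i i≤u) (role-self {u})

  role-origin : ∀ {u} → u ≢ 0 → role u 0 ≡ origin
  role-origin {u} u≢0 rewrite dec-false (0 ≟ u) (u≢0 ∘ sym) = refl

  role-pure : ∀ {u v} → v ≢ u → v ≢ 0 → v < M → role u v ≡ pure
  role-pure {u} {v} v≢u v≢0 v<M rewrite dec-false (v ≟ u) v≢u | dec-false (v ≟ 0) v≢0 | dec-true (v <? M) v<M = refl

  role-hyper : ∀ {u v} → v ≢ u → M ≤ v → role u v ≡ hyper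
  role-hyper {u} {v} v≢u M≤v
    rewrite dec-false (v ≟ u) v≢u | dec-false (v ≟ 0) (hyper⇒≢0 M≤v) | dec-false (v <? M) (≤⇒≯ M≤v) = refl

  distance : Kind → Role → ℕ
  distance _ self = 0
  distance origin _ = 1
  distance pure hyper = 2
  distance pure _ = 1
  distance hyper origin = 1
  distance hyper _ = 2

  detour : Kind → Role → ℕ
  detour _ self = 0
  detour origin pure = M ∸ 1
  detour origin _ = 1
  detour pure hyper = M
  detour pure _ = M ∸ 1
  detour hyper origin = 1
  detour hyper pure = M
  detour hyper hyper = 2

  data Placement : ℕ → ℕ → Kind → Role → Set where
    same         : ∀ {u κ} → Placement u u κ self
    origin-pure  : ∀ {v} → v ≢ 0 → v < M → Placement 0 v origin pure
    origin-hyper : ∀ {v} → M ≤ v → Placement 0 v origin hyper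
    pure-origin  : ∀ {u} → u ≢ 0 → u < M → Placement u 0 pure origin
    pure-pure    : ∀ {u v} → u < M → v < M → u ≢ v → Placement u v pure pure
    pure-hyper   : ∀ {u v} → u ≢ 0 → u < M → M ≤ v → Placement u v pure hyper
    hyper-origin : ∀ {u} → M ≤ u → Placement u 0 hyper origin
    hyper-pure   : ∀ {u v} → M ≤ u → v ≢ 0 → v < M → Placement u v hyper pure
    hyper-hyper  : ∀ {u v} → M ≤ u → M ≤ v → u ≢ v → Placement u v hyper hyper

  placement : ∀ u v → Placement u v (kind u) (role u v)
  placement u v with v ≟ u
  ... | yes refl rewrite role-self {u} = same
  ... | no v≢u with u ≟ 0 | v ≟ 0 | v <? M
  ...   | yes refl | yes refl | _ = ⊥-elim (v≢u refl)
  ...   | yes refl | no v≢0 | yes v<M rewrite role-pure v≢u v≢0 v<M = origin-pure v≢0 v<M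
  ...   | yes refl | no v≢0 | no v≮M rewrite role-hyper v≢u (≮⇒≥ v≮M) = origin-hyper (≮⇒≥ v≮M)
  ...   | no u≢0 | yes refl | _ with u <? M
  ...     | yes u<M rewrite kind-pure u≢0 u<M | role-origin u≢0 = pure-origin u≢0 u<M
  ...     | no u≮M rewrite kind-hyper (≮⇒≥ u≮M) | role-origin u≢0 = hyper-origin (≮⇒≥ u≮M)
  placement u v | no v≢u | no u≢0 | no v≢0 | yes v<M with u <? M
  ...     | yes u<M rewrite kind-pure u≢0 u<M | role-pure v≢u v≢0 v<M = pure-pure u<M v<M (v≢u ∘ sym)
  ...     | no u≮M rewrite kind-hyper (≮⇒≥ u≮M) | role-pure v≢u v≢0 v<M = hyper-pure (≮⇒≥ u≮M) v≢0 v<M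
  placement u v | no v≢u | no u≢0 | no v≢0 | no v≮M with u <? M
  ...     | yes u<M rewrite kind-pure u≢0 u<M | role-hyper v≢u (≮⇒≥ v≮M) = pure-hyper u≢0 u<M (≮⇒≥ v≮M)
  ...     | no u≮M rewrite kind-hyper (≮⇒≥ u≮M) | role-hyper v≢u (≮⇒≥ v≮M) =
    hyper-hyper (≮⇒≥ u≮M) (≮⇒≥ v≮M) (v≢u ∘ sym)

  ¬cliqueStar : ∀ {u v} → u ≢ 0 → v ≢ 0 → M ≤ u ⊎ M ≤ v → ¬ CliqueStar M u v
  ¬cliqueStar _ _ (inj₁ M≤u) (inj₁ (u<M , _)) = <⇒≱ u<M M≤u
  ¬cliqueStar _ _ (inj₂ M≤v) (inj₁ (_ , v<M)) = <⇒≱ v<M M≤v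
  ¬cliqueStar u≢0 _ _ (inj₂ (inj₁ (u≡0 , _))) = u≢0 u≡0
  ¬cliqueStar _ v≢0 _ (inj₂ (inj₂ (_ , v≡0))) = v≢0 v≡0

  distance-correct : ∀ {u v} → u < N → v < N → Dist n u v (distance (kind u) (role u v))
  distance-correct {u} {v} u<N v<N with kind u | role u v | placement u v
  ... | _ | _ | same = dist-refl u<N
  ... | _ | _ | origin-pure v≢0 v<M = dist-adjacent (adjacent-pure 0<M v<M (v≢0 ∘ sym))
  ... | _ | _ | origin-hyper M≤v = dist-adjacent (adjacent-origin-hyper M≤v v<N)
  ... | _ | _ | pure-origin u≢0 u<M = dist-adjacent (adjacent-pure u<M 0<M u≢0)
  ... | _ | _ | pure-pure u<M v<M u≢v = dist-adjacent (adjacent-pure u<M v<M u≢v)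
  ... | _ | _ | pure-hyper u≢0 u<M M≤v =
    dist-two (adjacent-pure u<M 0<M u≢0) (adjacent-origin-hyper M≤v v<N) (λ { refl → <⇒≱ u<M M≤v })
      (¬cliqueStar u≢0 (hyper⇒≢0 M≤v) (inj₂ M≤v))
  ... | _ | _ | hyper-origin M≤u = dist-adjacent (adjacent-hyper-origin M≤u u<N)
  ... | _ | _ | hyper-pure M≤u v≢0 v<M =
    dist-two (adjacent-hyper-origin M≤u u<N) (adjacent-pure 0<M v<M (v≢0 ∘ sym)) (λ { refl → <⇒≱ v<M M≤u })
      (¬cliqueStar (hyper⇒≢0 M≤u) v≢0 (inj₁ M≤u))
  ... | _ | _ | hyper-hyper M≤u M≤v u≢v =
    dist-two (adjacent-hyper-origin M≤u u<N) (adjacent-origin-hyper M≤v v<N) u≢v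
      (¬cliqueStar (hyper⇒≢0 M≤u) (hyper⇒≢0 M≤v) (inj₁ M≤u))

  detour-correct : ∀ {u v} → u < N → v < N → Detour n u v (detour (kind u) (role u v))
  detour-correct {u} {v} u<N v<N with kind u | role u v | placement u v
  ... | _ | _ | same = detour-refl u<N
  ... | _ | _ | origin-pure v≢0 v<M = detour-pure-pure 0<M v<M (v≢0 ∘ sym)
  ... | _ | _ | origin-hyper M≤v = detour-origin-hyper M≤v v<N
  ... | _ | _ | pure-origin u≢0 u<M = detour-pure-pure u<M 0<M u≢0
  ... | _ | _ | pure-pure u<M v<M u≢v = detour-pure-pure u<M v<M u≢v
  ... | _ | _ | pure-hyper u≢0 u<M M≤v = detour-pure-hyper u<M u≢0 M≤v v<N
  ... | _ | _ | hyper-origin M≤u = detour-hyper-origin M≤u u<N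
  ... | _ | _ | hyper-pure M≤u v≢0 v<M = detour-hyper-pure v<M v≢0 M≤u u<N
  ... | _ | _ | hyper-hyper M≤u M≤v u≢v = detour-hyper-hyper M≤u u<N M≤v v<N u≢v

  -- size κ r vertices have role r relative to any vertex of kind κ.
  size : Kind → Role → ℕ
  size origin self = 1
  size origin origin = 0
  size origin pure = M ∸ 1
  size origin hyper = M
  size pure self = 1
  size pure origin = 1
  size pure pure = M ∸ 2
  size pure hyper = M
  size hyper self = 1
  size hyper origin = 1
  size hyper pure = M ∸ 1
  size hyper hyper = M ∸ 1

  tally : Kind → (Role → ℕ) → ℕ → ℕ
  tally κ T k = ifEq (T self) k (size κ self) + ifEq (T origin) k (size κ origin)
              + ifEq (T pure) k (size κ pure) + ifEq (T hyper) k (size κ hyper)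

  tally-≡ : ∀ κ T k {a b c d} →
    ifEq (T self) k (size κ self) ≡ a → ifEq (T origin) k (size κ origin) ≡ b →
    ifEq (T pure) k (size κ pure) ≡ c → ifEq (T hyper) k (size κ hyper) ≡ d →
    tally κ T k ≡ a + b + c + d
  tally-≡ κ T k refl refl refl refl = refl

  pure-block-sizes : ∀ {u} → 1 ≤ u → u < M → u ∸ 1 + (M ∸ suc u) ≡ M ∸ 2
  pure-block-sizes {suc u-1} _ u<M = begin
    u-1 + (M ∸ suc (suc u-1))              ≡⟨ m+n∸n≡m (u-1 + (M ∸ suc (suc u-1))) 2 ⟨
    u-1 + (M ∸ suc (suc u-1)) + 2 ∸ 2      ≡⟨ cong (_∸ 2) (trans (+-comm (u-1 + (M ∸ suc (suc u-1))) 2) (m+[n∸m]≡n u<M)) ⟩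
    M ∸ 2                                  ∎

  hyper-block-sizes : ∀ {u} → M ≤ u → u < N → u ∸ M + (N ∸ suc u) ≡ M ∸ 1
  hyper-block-sizes {u} M≤u u<N = cong pred (+-cancelˡ-≡ M _ _ (begin
    M + suc (u ∸ M + (N ∸ suc u))     ≡⟨ +-suc M _ ⟩
    suc (M + (u ∸ M + (N ∸ suc u)))   ≡⟨ cong suc (+-assoc M (u ∸ M) (N ∸ suc u)) ⟨
    suc (M + (u ∸ M) + (N ∸ suc u))   ≡⟨ cong (λ x → suc (x + (N ∸ suc u))) (m+[n∸m]≡n M≤u) ⟩
    suc u + (N ∸ suc u)               ≡⟨ m+[n∸m]≡n u<N ⟩
    N                                 ≡⟨ N≡M+M ⟩
    M + M                             ∎))

  -- [0, 2m) is cut into consecutive blocks on each of which role u is constant.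
  count-role-origin : ∀ T k → count (T ∘ role 0) k (upTo N) ≡ tally origin T k
  count-role-origin T k = begin
    c N                   ≡⟨ count-upTo-extend δ k M M (sym N≡M+M) (λ M≤i _ → cong T (role-hyper (hyper⇒≢0 M≤i) M≤i)) ⟩
    c M + h               ≡⟨ cong (_+ h) (count-upTo-extend δ k 1 (M ∸ 1) suc[M∸1]≡M
                               (λ { (s≤s z≤n) i<M → cong T (role-pure {0} (λ ()) (λ ()) i<M) })) ⟩
    c 1 + p + h           ≡⟨ cong (λ x → x + p + h) (count-upTo-extend δ k 0 1 refl (λ { _ (s≤s z≤n) → cong T (role-self {0}) })) ⟩
    s + p + h             ≡⟨ cong (λ x → x + p + h) (trans (cong (s +_) (ifEq-zero (T origin) k)) (+-identityʳ s)) ⟨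
    tally origin T k      ∎
    where
    δ c : ℕ → ℕ
    δ = T ∘ role 0
    c x = count δ k (upTo x)
    s p h : ℕ
    s = ifEq (T self) k 1
    p = ifEq (T pure) k (M ∸ 1)
    h = ifEq (T hyper) k M

  count-role-pure : ∀ {u} → u ≢ 0 → u < M → ∀ T k → count (T ∘ role u) k (upTo N) ≡ tally pure T k
  count-role-pure {zero} u≢0 _ = ⊥-elim (u≢0 refl)
  count-role-pure {u@(suc u-1)} u≢0 u<M T k = begin
    c N                       ≡⟨ count-upTo-extend δ k M M (sym N≡M+M) (λ M≤i _ → cong T (role-hyper (λ { refl → <⇒≱ u<M M≤i }) M≤i)) ⟩
    c M + h                   ≡⟨ cong (_+ h) (count-upTo-extend δ k (suc u) (M ∸ suc u) (m+[n∸m]≡n u<M)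
                                   (λ u<i i<M → cong T (role-pure (>⇒≢ u<i) (λ { refl → <⇒≱ u<i z≤n }) i<M))) ⟩
    c (suc u) + p₂ + h        ≡⟨ cong (λ x → x + p₂ + h) (count-upTo-extend δ k u 1 (+-comm u 1)
                                   (λ u≤i i≤u → cong T (role-self-block u≤i i≤u))) ⟩
    c u + s + p₂ + h          ≡⟨ cong (λ x → x + s + p₂ + h) (count-upTo-extend δ k 1 u-1 refl
                                   (λ 1≤i i<u → cong T (role-pure (<⇒≢ i<u) (λ { refl → <⇒≱ 1≤i z≤n }) (<-trans i<u u<M)))) ⟩
    c 1 + p₁ + s + p₂ + h     ≡⟨ cong (λ x → x + p₁ + s + p₂ + h) (count-upTo-extend δ k 0 1 refl
                                   (λ { _ (s≤s z≤n) → cong T (role-origin u≢0) })) ⟩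
    o + p₁ + s + p₂ + h       ≡⟨ cong (_+ h) (regroup o p₁ s p₂) ⟩
    s + o + (p₁ + p₂) + h     ≡⟨ cong (λ x → s + o + x + h) (ifEq-+ (T pure) k u-1 (M ∸ suc u)) ⟩
    s + o + ifEq (T pure) k (u-1 + (M ∸ suc u)) + h
                              ≡⟨ cong (λ x → s + o + ifEq (T pure) k x + h) (pure-block-sizes (s≤s z≤n) u<M) ⟩
    tally pure T k            ∎
    where
    δ c : ℕ → ℕ
    δ = T ∘ role u
    c x = count δ k (upTo x)
    o s p₁ p₂ h : ℕ
    o = ifEq (T origin) k 1
    s = ifEq (T self) k 1
    p₁ = ifEq (T pure) k u-1
    p₂ = ifEq (T pure) k (M ∸ suc u)
    h = ifEq (T hyper) k M
    regroup : ∀ o p₁ s p₂ → o + p₁ + s + p₂ ≡ s + o + (p₁ + p₂)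
    regroup = solve-∀

  count-role-hyper : ∀ {u} → M ≤ u → u < N → ∀ T k → count (T ∘ role u) k (upTo N) ≡ tally hyper T k
  count-role-hyper {u} M≤u u<N T k = begin
    c N                       ≡⟨ count-upTo-extend δ k (suc u) (N ∸ suc u) (m+[n∸m]≡n u<N)
                                   (λ u<i _ → cong T (role-hyper (>⇒≢ u<i) (≤-trans M≤u (<⇒≤ u<i)))) ⟩
    c (suc u) + h₂            ≡⟨ cong (_+ h₂) (count-upTo-extend δ k u 1 (+-comm u 1)
                                   (λ u≤i i≤u → cong T (role-self-block u≤i i≤u))) ⟩
    c u + s + h₂              ≡⟨ cong (λ x → x + s + h₂) (count-upTo-extend δ k M (u ∸ M) (m+[n∸m]≡n M≤u)
                                   (λ M≤i i<u → cong T (role-hyper (<⇒≢ i<u) M≤i))) ⟩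
    c M + h₁ + s + h₂         ≡⟨ cong (λ x → x + h₁ + s + h₂) (count-upTo-extend δ k 1 (M ∸ 1) suc[M∸1]≡M
                                   (λ 1≤i i<M → cong T (role-pure (λ { refl → <⇒≱ i<M M≤u }) (λ { refl → <⇒≱ 1≤i z≤n }) i<M))) ⟩
    c 1 + p + h₁ + s + h₂     ≡⟨ cong (λ x → x + p + h₁ + s + h₂) (count-upTo-extend δ k 0 1 refl
                                   (λ { _ (s≤s z≤n) → cong T (role-origin (hyper⇒≢0 M≤u)) })) ⟩
    o + p + h₁ + s + h₂       ≡⟨ regroup o p h₁ s h₂ ⟩
    s + o + p + (h₁ + h₂)     ≡⟨ cong (s + o + p +_) (ifEq-+ (T hyper) k (u ∸ M) (N ∸ suc u)) ⟩
    s + o + p + ifEq (T hyper) k (u ∸ M + (N ∸ suc u))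
                              ≡⟨ cong (λ x → s + o + p + ifEq (T hyper) k x) (hyper-block-sizes M≤u u<N) ⟩
    tally hyper T k           ∎
    where
    δ c : ℕ → ℕ
    δ = T ∘ role u
    c x = count δ k (upTo x)
    o s p h₁ h₂ : ℕ
    o = ifEq (T origin) k 1
    s = ifEq (T self) k 1
    p = ifEq (T pure) k (M ∸ 1)
    h₁ = ifEq (T hyper) k (u ∸ M)
    h₂ = ifEq (T hyper) k (N ∸ suc u)
    regroup : ∀ o p h₁ s h₂ → o + p + h₁ + s + h₂ ≡ s + o + p + (h₁ + h₂)
    regroup = solve-∀

  count-role : ∀ {u} → u < N → ∀ T k → count (T ∘ role u) k (upTo N) ≡ tally (kind u) T k
  count-role {u} u<N with u ≟ 0 | u <? M
  ... | yes refl | _ = count-role-origin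
  ... | no u≢0 | yes u<M rewrite kind-pure u≢0 u<M = count-role-pure u≢0 u<M
  ... | no _ | no u≮M rewrite kind-hyper (≮⇒≥ u≮M) = count-role-hyper (≮⇒≥ u≮M) u<N

  farthestRole : Kind → Role
  farthestRole origin = pure
  farthestRole pure = hyper
  farthestRole hyper = pure

  farthest : Kind → ℕ
  farthest origin = 1
  farthest pure = M
  farthest hyper = 1

  farthest-vertex : ∀ u → farthest (kind u) < N
  farthest-vertex u with kind u
  ... | origin = pure⇒vertex 1<M
  ... | pure = M<N
  ... | hyper = pure⇒vertex 1<M

  role-farthest : ∀ {u} → u < N → role u (farthest (kind u)) ≡ farthestRole (kind u)
  role-farthest {u} u<N with u ≟ 0 | u <? M
  ... | yes refl | _ = role-pure {0} (λ ()) (λ ()) 1<M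
  ... | no u≢0 | yes u<M rewrite kind-pure u≢0 u<M = role-hyper {u} (λ { refl → <-irrefl refl u<M }) ≤-refl
  ... | no _ | no u≮M rewrite kind-hyper (≮⇒≥ u≮M) = role-pure {u} (λ { refl → u≮M 1<M }) (λ ()) 1<M

  dds-by-role : ∀ (D : ℕ → ℕ → ℕ → ℕ → Set) (T : Kind → Role → ℕ) (e : Kind → ℕ) (S : Kind → List ℕ) →
    (∀ {u v a b} → D n u v a → D n u v b → a ≡ b) →
    (∀ {u v} → u < N → v < N → D n u v (T (kind u) (role u v))) →
    (∀ κ r → T κ r ≤ e κ) →
    (∀ κ → T κ (farthestRole κ) ≡ e κ) →
    (∀ κ → applyUpTo (tally κ (T κ)) (suc (e κ)) ≡ S κ) →
    ∀ {u} → u < N → DDSwrt D n u (S (kind u))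
  dds-by-role D T e S functional correct bounded attained sequence {u} u<N =
    subst (DDSwrt D n u) (sequence (kind u))
      (DDSwrt-intro D (T (kind u) ∘ role u) (tally (kind u) (T (kind u))) (e (kind u))
        functional (correct u<N) (count-role u<N (T (kind u))) (λ {v} _ → bounded (kind u) (role u v))
        (farthest-vertex u) (trans (cong (T (kind u)) (role-farthest u<N)) (attained (kind u))))

  distanceEcc : Kind → ℕ
  distanceEcc origin = 1
  distanceEcc pure = 2
  distanceEcc hyper = 2

  distanceSeq : Kind → List ℕ
  distanceSeq origin = 1 ∷ N ∸ 1 ∷ []
  distanceSeq pure = 1 ∷ M ∸ 1 ∷ M ∷ []
  distanceSeq hyper = 1 ∷ 1 ∷ N ∸ 2 ∷ []

  distance-bounded : ∀ κ r → distance κ r ≤ distanceEcc κ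
  distance-bounded origin self = z≤n
  distance-bounded origin origin = ≤-refl
  distance-bounded origin pure = ≤-refl
  distance-bounded origin hyper = ≤-refl
  distance-bounded pure self = z≤n
  distance-bounded pure origin = s≤s z≤n
  distance-bounded pure pure = s≤s z≤n
  distance-bounded pure hyper = ≤-refl
  distance-bounded hyper self = z≤n
  distance-bounded hyper origin = s≤s z≤n
  distance-bounded hyper pure = ≤-refl
  distance-bounded hyper hyper = ≤-refl

  distance-farthest : ∀ κ → distance κ (farthestRole κ) ≡ distanceEcc κ
  distance-farthest origin = refl
  distance-farthest pure = refl
  distance-farthest hyper = refl

  distance-sequence : ∀ κ → applyUpTo (tally κ (distance κ)) (suc (distanceEcc κ)) ≡ distanceSeq κ
  distance-sequence origin = cong (λ x → 1 ∷ x ∷ []) (trans (sym (+-∸-comm M 0<M)) (cong (_∸ 1) (sym N≡M+M)))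
  distance-sequence pure = cong (λ x → 1 ∷ x ∷ M ∷ []) (trans (+-identityʳ _) (suc[m∸2]≡m∸1 1<M))
  distance-sequence hyper = cong (λ x → 1 ∷ 1 ∷ x ∷ []) (trans ([m∸1]+[m∸1]≡m+m∸2 0<M) (cong (_∸ 2) (sym N≡M+M)))

  dds : ∀ {u} → u < N → DDS n u (distanceSeq (kind u))
  dds = dds-by-role Dist distance distanceEcc distanceSeq
          Dist-functional distance-correct distance-bounded distance-farthest distance-sequence

  detourEcc : Kind → ℕ
  detourEcc origin = M ∸ 1
  detourEcc pure = M
  detourEcc hyper = M

  detourSeq : Kind → List ℕ
  detourSeq origin = (1 ∷ M ∷ []) ++ replicate (M ∸ 3) 0 ++ (M ∸ 1 ∷ [])
  detourSeq pure = (1 ∷ []) ++ replicate (M ∸ 2) 0 ++ (M ∸ 1 ∷ M ∷ [])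
  detourSeq hyper = (1 ∷ 1 ∷ M ∸ 1 ∷ []) ++ replicate (M ∸ 3) 0 ++ (M ∸ 1 ∷ [])

  detour-bounded : ∀ κ r → detour κ r ≤ detourEcc κ
  detour-bounded origin self = z≤n
  detour-bounded origin origin = <⇒≤ 1<M∸1
  detour-bounded origin pure = ≤-refl
  detour-bounded origin hyper = <⇒≤ 1<M∸1
  detour-bounded pure self = z≤n
  detour-bounded pure origin = <⇒≤ M∸1<M
  detour-bounded pure pure = <⇒≤ M∸1<M
  detour-bounded pure hyper = ≤-refl
  detour-bounded hyper self = z≤n
  detour-bounded hyper origin = <⇒≤ 1<M
  detour-bounded hyper pure = ≤-refl
  detour-bounded hyper hyper = <⇒≤ 2<M

  detour-farthest : ∀ κ → detour κ (farthestRole κ) ≡ detourEcc κ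
  detour-farthest origin = refl
  detour-farthest pure = refl
  detour-farthest hyper = refl

  detour-sequence-origin : applyUpTo (tally origin (detour origin)) (suc (detourEcc origin)) ≡ detourSeq origin
  detour-sequence-origin =
    applyUpTo-shape f 2 (M ∸ 3) 1 (cong pred (m+[n∸m]≡n 2<M)) (+-comm (M ∸ 1) 1)
      (cong₂ (λ x y → x ∷ y ∷ []) f0 f1) gap (cong (_∷ []) f[M∸1])
    where
    f : ℕ → ℕ
    f = tally origin (detour origin)
    f0 : f 0 ≡ 1
    f0 = tally-≡ origin (detour origin) 0 refl (ifEq-zero 1 0) (ifEq-≢ (M ∸ 1) M∸1≢0) refl
    f1 : f 1 ≡ M
    f1 = tally-≡ origin (detour origin) 1 refl (ifEq-zero 1 1) (ifEq-≢ (M ∸ 1) M∸1≢1) refl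
    gap : ∀ {i} → 2 ≤ i → i < M ∸ 1 → f i ≡ 0
    gap {i} (s≤s (s≤s _)) i<M∸1 =
      tally-≡ origin (detour origin) i refl (ifEq-zero 1 i) (ifEq-≢ (M ∸ 1) (>⇒≢ i<M∸1)) refl
    f[M∸1] : f (M ∸ 1) ≡ M ∸ 1
    f[M∸1] = trans (tally-≡ origin (detour origin) (M ∸ 1) (ifEq-≢ 1 (M∸1≢0 ∘ sym)) (ifEq-zero 1 (M ∸ 1))
                      (ifEq-refl (M ∸ 1) (M ∸ 1)) (ifEq-≢ M (M∸1≢1 ∘ sym)))
                   (+-identityʳ (M ∸ 1))

  detour-sequence-pure : applyUpTo (tally pure (detour pure)) (suc (detourEcc pure)) ≡ detourSeq pure
  detour-sequence-pure =
    applyUpTo-shape f 1 (M ∸ 2) 2 (cong pred (m+[n∸m]≡n 1<M)) (trans (+-comm (M ∸ 1) 2) (cong suc suc[M∸1]≡M))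
      (cong (_∷ []) f0) gap (cong₂ (λ x y → x ∷ y ∷ []) f[M∸1] (trans (cong f suc[M∸1]≡M) fM))
    where
    f : ℕ → ℕ
    f = tally pure (detour pure)
    f0 : f 0 ≡ 1
    f0 = tally-≡ pure (detour pure) 0 refl (ifEq-≢ 1 M∸1≢0) (ifEq-≢ (M ∸ 2) M∸1≢0) (ifEq-≢ M (>⇒≢ 0<M))
    gap : ∀ {i} → 1 ≤ i → i < M ∸ 1 → f i ≡ 0
    gap {i} (s≤s _) i<M∸1 =
      tally-≡ pure (detour pure) i refl (ifEq-≢ 1 (>⇒≢ i<M∸1)) (ifEq-≢ (M ∸ 2) (>⇒≢ i<M∸1))
        (ifEq-≢ M (>⇒≢ (<-trans i<M∸1 M∸1<M)))
    f[M∸1] : f (M ∸ 1) ≡ M ∸ 1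
    f[M∸1] = trans (tally-≡ pure (detour pure) (M ∸ 1) (ifEq-≢ 1 (M∸1≢0 ∘ sym)) (ifEq-refl (M ∸ 1) 1)
                      (ifEq-refl (M ∸ 1) (M ∸ 2)) (ifEq-≢ M (>⇒≢ M∸1<M)))
                   (trans (+-identityʳ (suc (M ∸ 2))) (suc[m∸2]≡m∸1 1<M))
    fM : f M ≡ M
    fM = tally-≡ pure (detour pure) M (ifEq-≢ 1 (<⇒≢ 0<M)) (ifEq-≢ 1 (<⇒≢ M∸1<M))
           (ifEq-≢ (M ∸ 2) (<⇒≢ M∸1<M)) (ifEq-refl M M)

  detour-sequence-hyper : applyUpTo (tally hyper (detour hyper)) (suc (detourEcc hyper)) ≡ detourSeq hyper
  detour-sequence-hyper =
    applyUpTo-shape f 3 (M ∸ 3) 1 (m+[n∸m]≡n 2<M) (+-comm M 1)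
      (cong₂ _∷_ f0 (cong₂ (λ x y → x ∷ y ∷ []) f1 f2)) gap (cong (_∷ []) fM)
    where
    f : ℕ → ℕ
    f = tally hyper (detour hyper)
    f0 : f 0 ≡ 1
    f0 = tally-≡ hyper (detour hyper) 0 refl refl (ifEq-≢ (M ∸ 1) (>⇒≢ 0<M)) refl
    f1 : f 1 ≡ 1
    f1 = tally-≡ hyper (detour hyper) 1 refl refl (ifEq-≢ (M ∸ 1) (>⇒≢ 1<M)) refl
    f2 : f 2 ≡ M ∸ 1
    f2 = tally-≡ hyper (detour hyper) 2 refl refl (ifEq-≢ (M ∸ 1) (>⇒≢ 2<M)) refl
    gap : ∀ {i} → 3 ≤ i → i < M → f i ≡ 0
    gap {i} (s≤s (s≤s (s≤s _))) i<M = tally-≡ hyper (detour hyper) i refl refl (ifEq-≢ (M ∸ 1) (>⇒≢ i<M)) refl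
    fM : f M ≡ M ∸ 1
    fM = trans (tally-≡ hyper (detour hyper) M (ifEq-≢ 1 (<⇒≢ 0<M)) (ifEq-≢ 1 (<⇒≢ 1<M))
                  (ifEq-refl M (M ∸ 1)) (ifEq-≢ (M ∸ 1) (<⇒≢ 2<M)))
               (+-identityʳ (M ∸ 1))

  detour-sequence : ∀ κ → applyUpTo (tally κ (detour κ)) (suc (detourEcc κ)) ≡ detourSeq κ
  detour-sequence origin = detour-sequence-origin
  detour-sequence pure = detour-sequence-pure
  detour-sequence hyper = detour-sequence-hyper

  ddsD : ∀ {u} → u < N → DDSD n u (detourSeq (kind u))
  ddsD = dds-by-role Detour detour detourEcc detourSeq
           Detour-functional detour-correct detour-bounded detour-farthest detour-sequence

  multiset-by-kind : ∀ (R : ℕ → ℕ → List ℕ → Set) (S : Kind → List ℕ) → (∀ {u} → u < N → R n u (S (kind u))) →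
    SeqMultiset R n ((S origin ∷ []) ++ replicate (M ∸ 1) (S pure) ++ replicate M (S hyper))
  multiset-by-kind R S R-S = S ∘ kind , (λ _ u<N → R-S u<N) , ↭-reflexive (trans (map-upTo (S ∘ kind) N)
    (applyUpTo-shape (S ∘ kind) 1 (M ∸ 1) M suc[M∸1]≡M (sym N≡M+M) refl
      (λ 1≤i i<M → cong S (kind-pure (λ { refl → <⇒≱ 1≤i z≤n }) i<M))
      (applyUpTo-constant (λ i → S (kind (i + M))) M (λ {i} _ → cong S (kind-hyper (m≤n+m M i))))))

  dds-multiset : SeqMultiset DDS n (ddsTarget n)
  dds-multiset = multiset-by-kind DDS distanceSeq dds

  ddsD-multiset : SeqMultiset DDSD n (ddsDTarget n)
  ddsD-multiset = multiset-by-kind DDSD detourSeq ddsD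

mainTheorem11 : (n : ℕ) → 3 ≤ n →
    SeqMultiset DDS n (ddsTarget n) × SeqMultiset DDSD n (ddsDTarget n)
mainTheorem11 (suc (suc k)) (s≤s (s≤s 1≤k)) = dds-multiset , ddsD-multiset
  where
  open Gyrogroup k using (N≡M+M; adjacent⇒cliqueStar; cliqueStar⇒adjacent)
  4≤M : 4 ≤ m (suc (suc k))
  4≤M = *-monoʳ-≤ 2 (^-monoʳ-≤ 2 1≤k)
  open PowerGraph (suc (suc k)) N≡M+M 4≤M adjacent⇒cliqueStar cliqueStar⇒adjacent
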